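{- Let $\Upsilon=\forall\bar u\,\exists y(\bar v)\ \varphi$ be a satisfiable 1-DQBF. (i) The number of Skolem functions of $\Upsilon$ is $2^m$, where $m=2^{|\bar v|}-|\{\bar c\in\mathbb{B}^{|\bar v|}:\neg\varphi[\bar v/\bar c]\text{ is satisfiable}\}|$. (ii) In particular, for a set $S\subseteq\mathbb{B}^{|\bar v|}$, the number of Skolem functions of $\Upsilon$ that differ on $S$ (i.e., the number of distinct restrictions to $S$ of Skolem functions of $\Upsilon$) is $2^m$, where $m=|S|-|\{\bar c\in S:\neg\varphi[\bar v/\bar c]\text{ is satisfiable}\}|$.
   Context: Let $\mathbb{B}=\{\bot,\top\}$. A 1-DQBF is $\Upsilon=\forall\bar u\,\exists y(\bar v)\ \varphi$, where $\bar v$ is a vector of distinct variables among the universal variables $\bar u$ and $\varphi$ is a quantifier-free Boolean formula over $\bar u$ and $y$. A Skolem function of $\Upsilon$ is a Boolean function $f:\mathbb{B}^{|\bar v|}\to\mathbb{B}$ of the variables $\bar v$ such that substituting $f$ for $y$ makes $\varphi$ a tautology; $\Upsilon$ is satisfiable if it has one. $\varphi[\bar v/\bar c]$ denotes $\varphi$ with $\bar v$ assigned $\bar c$, and its satisfiability refers to assignments to the remaining variables (including $y$). -}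

module Defs where

open import Level using (0ℓ)
open import Data.Bool using (Bool; true; false; not; _∧_; _∨_)
open import Data.Nat using (ℕ)
open import Data.Fin using (Fin)
open import Data.Vec using (Vec; map)
open import Data.Product using (Σ; ∃; ∃-syntax; _×_; proj₁)
open import Relation.Binary.PropositionalEquality using (_≡_; refl; sym; trans)
open import Relation.Binary.Bundles using (Setoid)
open import Function.Bundles using (Inverse)
open import Data.Unit using (⊤)
import Relation.Binary.PropositionalEquality as P

data Formula (n : ℕ) : Set where
  uvar  : Fin n → Formula n
  yvar  : Formula n
  const : Bool → Formula n
  ¬f_   : Formula n → Formula n
  _∧f_  : Formula n → Formula n → Formula n
  _∨f_  : Formula n → Formula n → Formula n

eval : ∀ {n} → Formula n → (Fin n → Bool) → Bool → Bool
eval (uvar i)  a b = a i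
eval yvar      a b = b
eval (const c) a b = c
eval (¬f φ)    a b = not (eval φ a b)
eval (φ ∧f ψ)  a b = eval φ a b ∧ eval ψ a b
eval (φ ∨f ψ)  a b = eval φ a b ∨ eval ψ a b

restrict : ∀ {n k} → Vec (Fin n) k → (Fin n → Bool) → Vec Bool k
restrict v a = map a v

-- The 1-DQBF  ∀ū ∃y(v̄) φ  is given by the pair (φ , v) (v has distinct entries).
-- f is a Skolem function: substituting f(v̄) for y makes φ a tautology.
IsSkolem : ∀ {n k} → Formula n → Vec (Fin n) k → (Vec Bool k → Bool) → Set
IsSkolem {n} φ v f = ∀ (a : Fin n → Bool) → eval φ a (f (restrict v a)) ≡ true

Satisfiable1DQBF : ∀ {n k} → Formula n → Vec (Fin n) k → Set
Satisfiable1DQBF {k = k} φ v = ∃[ f ] IsSkolem φ v f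

-- ¬φ[v̄/c̄] is satisfiable: some assignment of the remaining variables
-- (the universals outside v̄, and y) falsifies φ when v̄ is set to c̄.
NegSat : ∀ {n k} → Formula n → Vec (Fin n) k → Vec Bool k → Set
NegSat {n} φ v c = ∃[ a ] ∃[ b ] (restrict v a ≡ c × eval φ a b ≡ false)

HasSize : Setoid 0ℓ 0ℓ → ℕ → Set
HasSize A t = Inverse (P.setoid (Fin t)) A

SubsetSetoid : ∀ {k} → (Vec Bool k → Set) → Setoid 0ℓ 0ℓ
SubsetSetoid {k} S = record
  { Carrier = Σ (Vec Bool k) S
  ; _≈_ = λ x y → proj₁ x ≡ proj₁ y
  ; isEquivalence = record { refl = refl ; sym = sym ; trans = trans } }

-- Skolem functions of (φ , v), identified when they agree on S
-- (i.e. the set of restrictions to S of Skolem functions).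
SkolemOn : ∀ {n k} → Formula n → Vec (Fin n) k → (Vec Bool k → Set) → Setoid 0ℓ 0ℓ
SkolemOn {n} {k} φ v S = record
  { Carrier = Σ (Vec Bool k → Bool) (IsSkolem φ v)
  ; _≈_ = λ f g → ∀ c → S c → proj₁ f c ≡ proj₁ g c
  ; isEquivalence = record
      { refl = λ c _ → refl
      ; sym = λ p c s → sym (p c s)
      ; trans = λ p q c s → trans (p c s) (q c s) } }

Everything : ∀ {k} → Vec Bool k → Set
Everything _ = ⊤

_∩_ : ∀ {k} → (Vec Bool k → Set) → (Vec Bool k → Set) → Vec Bool k → Set
(S ∩ T) c = S c × T c

-- Fix one Skolem function g. A function f is Skolem exactly when it agrees with g on every c̄
-- for which ¬φ[v̄/c̄] is satisfiable: there some (ū, y) falsifies φ, so the value of y is forced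
-- to be the other Boolean, while every other c̄ leaves y unconstrained. Hence Skolem functions,
-- up to agreement on S, are free Boolean choices on the s − t points of S whose value is not
-- forced.
module Submission where

open import Data.Bool using (Bool; true; false)
open import Data.Bool.Properties using (_≟_; ¬-not)
open import Data.Fin using (Fin; zero; suc)
open import Data.Fin.Permutation using (↔⇒≡)
open import Data.Fin.Properties using (any?; suc-injective; 2↔Bool; *↔×)
open import Data.Nat using (ℕ; zero; suc; _+_; _^_; _∸_)
open import Data.Nat.Properties using (+-suc; m+n∸m≡n)
open import Data.Product using (Σ; ∃; _,_; proj₁; proj₂; _×_)
open import Data.Product.Function.NonDependent.Propositional using (_×-↔_)
open import Data.Unit using (tt)
open import Data.Vec using (Vec; []; _∷_; lookup; tabulate)
open import Data.Vec.Properties using (≡-dec; lookup∘tabulate; tabulate∘lookup; tabulate-cong)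
open import Data.Vec.Relation.Unary.Unique.Propositional using (Unique)
open import Function using (_∘_; _↔_; Inverse; mk↔ₛ′)
import Function.Construct.Composition as Compose
import Function.Construct.Symmetry as Symmetry
open import Function.Properties.Inverse using (↔-trans)
open import Level using (0ℓ)
open import Relation.Binary.Bundles using (Setoid)
open import Relation.Binary.PropositionalEquality
  using (_≡_; _≢_; refl; sym; trans; cong; cong₂; subst; setoid; module ≡-Reasoning)
open import Relation.Nullary using (Dec; yes; no; does; ¬_; contradiction)
open import Defs

module _ {n k} (φ : Formula n) (v : Vec (Fin n) k) {g : Vec Bool k → Bool}
         (g-skolem : IsSkolem φ v g) where

  skolem-agrees-on-NegSat : ∀ {f} → IsSkolem φ v f → ∀ c → NegSat φ v c → f c ≡ g c
  skolem-agrees-on-NegSat {f} f-skolem c (a , b , refl , falsified) =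
    trans (¬-not (avoids f f-skolem)) (sym (¬-not (avoids g g-skolem)))
    where
    avoids : ∀ h → IsSkolem φ v h → h (restrict v a) ≢ b
    avoids h h-skolem refl = contradiction (trans (sym (h-skolem a)) falsified) λ ()

  agrees-on-NegSat⇒skolem : ∀ {f} → (∀ c → NegSat φ v c → f c ≡ g c) → IsSkolem φ v f
  agrees-on-NegSat⇒skolem {f} agrees a with eval φ a (f (restrict v a)) in falsified
  ... | true  = refl
  ... | false = contradiction true≡false λ ()
    where
    open ≡-Reasoning
    true≡false : true ≡ false
    true≡false = begin
      true                        ≡⟨ sym (g-skolem a) ⟩
      eval φ a (g (restrict v a)) ≡⟨ cong (eval φ a) (sym (agrees _ (a , _ , refl , falsified))) ⟩
      eval φ a (f (restrict v a)) ≡⟨ falsified ⟩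
      false                       ∎

HasSize-unique : ∀ {A : Setoid 0ℓ 0ℓ} {s t} → HasSize A s → HasSize A t → s ≡ t
HasSize-unique A-s A-t = ↔⇒≡ (Compose.inverse A-s (Symmetry.inverse A-t))

∷-↔ : ∀ {A : Set} {k} → (A × Vec A k) ↔ Vec A (suc k)
∷-↔ = mk↔ₛ′ (λ (x , xs) → x ∷ xs) (λ { (x ∷ xs) → x , xs })
            (λ { (x ∷ xs) → refl }) (λ (x , xs) → refl)

Fin[2^]↔Vec-Bool : ∀ k → Fin (2 ^ k) ↔ Vec Bool k
Fin[2^]↔Vec-Bool zero    = mk↔ₛ′ (λ _ → []) (λ _ → zero) (λ { [] → refl }) (λ { zero → refl })
Fin[2^]↔Vec-Bool (suc k) = ↔-trans *↔× (↔-trans (2↔Bool ×-↔ Fin[2^]↔Vec-Bool k) ∷-↔)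

Everything-size : ∀ k → HasSize (SubsetSetoid {k} Everything) (2 ^ k)
Everything-size k = Compose.inverse (Fin[2^]↔Vec-Bool k) record
  { to        = λ c → c , tt
  ; from      = proj₁
  ; to-cong   = λ eq → eq
  ; from-cong = λ eq → eq
  ; inverse   = (λ eq → eq) , (λ eq → eq)
  }

Everything∩-size : ∀ {k} {P : Vec Bool k → Set} {t} →
                   HasSize (SubsetSetoid P) t → HasSize (SubsetSetoid (Everything ∩ P)) t
Everything∩-size P-size = Compose.inverse P-size record
  { to        = λ (c , c∈P) → c , tt , c∈P
  ; from      = λ (c , _ , c∈P) → c , c∈P
  ; to-cong   = λ eq → eq
  ; from-cong = λ eq → eq
  ; inverse   = (λ eq → eq) , (λ eq → eq)
  }

image? : ∀ {k m} (e : Fin m → Vec Bool k) c → Dec (∃ λ i → e i ≡ c)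
image? e c = any? (λ i → ≡-dec _≟_ (e i) c)

count : ∀ {s} → (Fin s → Bool) → Bool → ℕ
count {zero}  Q b = zero
count {suc s} Q b with Q zero ≟ b
... | yes _ = suc (count (Q ∘ suc) b)
... | no  _ = count (Q ∘ suc) b

count-true+count-false : ∀ {s} (Q : Fin s → Bool) → count Q true + count Q false ≡ s
count-true+count-false {zero}  Q = refl
count-true+count-false {suc s} Q with Q zero ≟ true | Q zero ≟ false
... | yes _   | no _    = cong suc (count-true+count-false (Q ∘ suc))
... | no _    | yes _   = trans (+-suc _ _) (cong suc (count-true+count-false (Q ∘ suc)))
... | yes Q≡t | yes Q≡f = contradiction (trans (sym Q≡t) Q≡f) λ ()
... | no Q≢t  | no Q≢f  = contradiction (¬-not Q≢t) Q≢f

select : ∀ {s} (Q : Fin s → Bool) b → Fin (count Q b) → Fin s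
select {suc s} Q b j with Q zero ≟ b
select {suc s} Q b zero    | yes _ = zero
select {suc s} Q b (suc j) | yes _ = suc (select (Q ∘ suc) b j)
select {suc s} Q b j       | no  _ = suc (select (Q ∘ suc) b j)

select-sound : ∀ {s} (Q : Fin s → Bool) b j → Q (select Q b j) ≡ b
select-sound {suc s} Q b j with Q zero ≟ b
select-sound {suc s} Q b zero    | yes Q0≡b = Q0≡b
select-sound {suc s} Q b (suc j) | yes _    = select-sound (Q ∘ suc) b j
select-sound {suc s} Q b j       | no  _    = select-sound (Q ∘ suc) b j

select-complete : ∀ {s} (Q : Fin s → Bool) b i → Q i ≡ b → ∃ λ j → select Q b j ≡ i
select-complete {suc s} Q b zero Q0≡b with Q zero ≟ b
... | yes _   = zero , refl
... | no Q0≢b = contradiction Q0≡b Q0≢b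
select-complete {suc s} Q b (suc i) Qi≡b with Q zero ≟ b | select-complete (Q ∘ suc) b i Qi≡b
... | yes _ | j , eq = suc j , cong suc eq
... | no  _ | j , eq = j , cong suc eq

select-injective : ∀ {s} (Q : Fin s → Bool) b {j j′} → select Q b j ≡ select Q b j′ → j ≡ j′
select-injective {suc s} Q b {j} {j′} eq with Q zero ≟ b
select-injective {suc s} Q b {zero}  {zero}   eq | yes _ = refl
select-injective {suc s} Q b {zero}  {suc j′} () | yes _
select-injective {suc s} Q b {suc j} {zero}   () | yes _
select-injective {suc s} Q b {suc j} {suc j′} eq | yes _ =
  cong suc (select-injective (Q ∘ suc) b (suc-injective eq))
select-injective {suc s} Q b {j} {j′} eq | no _ = select-injective (Q ∘ suc) b (suc-injective eq)

module Enumeration {k} {S : Vec Bool k → Set} {s} (S-size : HasSize (SubsetSetoid S) s) where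
  open Inverse S-size

  enum : Fin s → Vec Bool k
  enum i = proj₁ (to i)

  enum-∈ : ∀ i → S (enum i)
  enum-∈ i = proj₂ (to i)

  enum-injective : ∀ {i j} → enum i ≡ enum j → i ≡ j
  enum-injective {i} eq = trans (sym (inverseʳ {i} {to i} refl)) (inverseʳ eq)

  position : ∀ c → S c → Fin s
  position c c∈S = from (c , c∈S)

  enum-position : ∀ c c∈S → enum (position c c∈S) ≡ c
  enum-position c c∈S = inverseˡ refl

module Split {k} {S T : Vec Bool k → Set} {s t}
             (S-size : HasSize (SubsetSetoid S) s)
             (ST-size : HasSize (SubsetSetoid (S ∩ T)) t) where
  open Enumeration S-size
  private module ST = Enumeration ST-size

  -- T need not be decidable; on S it is decided by searching the enumeration of S ∩ T.
  marked : Fin s → Bool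
  marked i = does (image? ST.enum (enum i))

  marked⇒∈ : ∀ {i} → marked i ≡ true → T (enum i)
  marked⇒∈ {i} marked-i with image? ST.enum (enum i)
  ... | yes (j , eq) = subst T eq (proj₂ (ST.enum-∈ j))
  ... | no _         = contradiction marked-i λ ()

  ∈⇒marked : ∀ {i} → T (enum i) → marked i ≡ true
  ∈⇒marked {i} enum-i∈T with image? ST.enum (enum i)
  ... | yes _      = refl
  ... | no enum-i∉ = contradiction (_ , ST.enum-position (enum i) (enum-∈ i , enum-i∈T)) enum-i∉

  marked-size : HasSize (SubsetSetoid (S ∩ T)) (count marked true)
  marked-size = record
    { to        = λ j → enum (select marked true j) , enum-∈ _
                        , marked⇒∈ (select-sound marked true j)
    ; from      = index
    ; to-cong   = λ { refl → refl }
    ; from-cong = λ {x} {y} eq → index-unique x (trans (enum-select-index y) (sym eq))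
    ; inverse   = (λ { {x} refl → enum-select-index x }) , (λ {j} {y} eq → index-unique y (sym eq))
    }
    where
    complete : ∀ {c} (c∈S : S c) → T c → ∃ λ j → select marked true j ≡ position c c∈S
    complete {c} c∈S c∈T =
      select-complete marked true _ (∈⇒marked (subst T (sym (enum-position c c∈S)) c∈T))
    index : Σ (Vec Bool k) (S ∩ T) → Fin (count marked true)
    index (_ , c∈S , c∈T) = proj₁ (complete c∈S c∈T)
    enum-select-index : ∀ x → enum (select marked true (index x)) ≡ proj₁ x
    enum-select-index (c , c∈S , c∈T) =
      trans (cong enum (proj₂ (complete c∈S c∈T))) (enum-position c c∈S)
    index-unique : ∀ x {j} → enum (select marked true j) ≡ proj₁ x → index x ≡ j
    index-unique x eq =
      select-injective marked true (enum-injective (trans (enum-select-index x) (sym eq)))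

  count-unmarked : count marked false ≡ s ∸ t
  count-unmarked = begin
    count marked false
      ≡⟨ sym (m+n∸m≡n (count marked true) _) ⟩
    count marked true + count marked false ∸ count marked true
      ≡⟨ cong₂ _∸_ (count-true+count-false marked) (HasSize-unique marked-size ST-size) ⟩
    s ∸ t
      ∎
    where open ≡-Reasoning

  free : Fin (count marked false) → Vec Bool k
  free = enum ∘ select marked false

  free-injective : ∀ {j j′} → free j ≡ free j′ → j ≡ j′
  free-injective eq = select-injective marked false (enum-injective eq)

  free-∈ : ∀ j → S (free j)
  free-∈ j = enum-∈ _

  free-∉ : ∀ j → ¬ T (free j)
  free-∉ j free-j∈T =
    contradiction (trans (sym (∈⇒marked free-j∈T)) (select-sound marked false j)) λ ()

  not-free⇒∈ : ∀ c → S c → ¬ (∃ λ j → free j ≡ c) → T c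
  not-free⇒∈ c c∈S not-free with marked (position c c∈S) in marked-c
  ... | true  = subst T (enum-position c c∈S) (marked⇒∈ marked-c)
  ... | false = let j , select-j = select-complete marked false _ marked-c in
    contradiction (j , trans (cong enum select-j) (enum-position c c∈S)) not-free

module SkolemCount {n k} (φ : Formula n) (v : Vec (Fin n) k) {g : Vec Bool k → Bool}
                   (g-skolem : IsSkolem φ v g) {S : Vec Bool k → Set} {s t}
                   (S-size : HasSize (SubsetSetoid S) s)
                   (SN-size : HasSize (SubsetSetoid (S ∩ NegSat φ v)) t) where
  open Split S-size SN-size

  extend : Vec Bool (count marked false) → Vec Bool k → Bool
  extend xs c with image? free c
  ... | yes (j , _) = lookup xs j
  ... | no  _       = g c

  extend-free : ∀ xs j → extend xs (free j) ≡ lookup xs j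
  extend-free xs j with image? free (free j)
  ... | yes (j′ , eq) = cong (lookup xs) (free-injective eq)
  ... | no not-free   = contradiction (j , refl) not-free

  extend-skolem : ∀ xs → IsSkolem φ v (extend xs)
  extend-skolem xs = agrees-on-NegSat⇒skolem φ v g-skolem agrees
    where
    agrees : ∀ c → NegSat φ v c → extend xs c ≡ g c
    agrees c c∈N with image? free c
    ... | yes (j , refl) = contradiction c∈N (free-∉ j)
    ... | no  _          = refl

  extend-tabulate : ∀ {f} → IsSkolem φ v f → ∀ c → S c → extend (tabulate (f ∘ free)) c ≡ f c
  extend-tabulate {f} f-skolem c c∈S with image? free c
  ... | yes (j , refl) = lookup∘tabulate (f ∘ free) j
  ... | no  not-free   =
    sym (skolem-agrees-on-NegSat φ v g-skolem f-skolem c (not-free⇒∈ c c∈S not-free))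

  free-values↔skolem : Inverse (setoid (Vec Bool (count marked false))) (SkolemOn φ v S)
  free-values↔skolem = record
    { to        = λ xs → extend xs , extend-skolem xs
    ; from      = λ (f , _) → tabulate (f ∘ free)
    ; to-cong   = λ { refl _ _ → refl }
    ; from-cong = λ f≈f′ → tabulate-cong (λ j → f≈f′ (free j) (free-∈ j))
    ; inverse   = (λ { {_ , f-skolem} refl → extend-tabulate f-skolem })
                , (λ {xs} f≈extend → trans (tabulate-cong (λ j → f≈extend (free j) (free-∈ j)))
                                           (trans (tabulate-cong (extend-free xs))
                                                  (tabulate∘lookup xs)))
    }

  skolem-size : HasSize (SkolemOn φ v S) (2 ^ (s ∸ t))
  skolem-size = subst (λ w → HasSize (SkolemOn φ v S) (2 ^ w)) count-unmarked
                      (Compose.inverse (Fin[2^]↔Vec-Bool _) free-values↔skolem)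

lemma6 : ∀ {n k} (φ : Formula n) (v : Vec (Fin n) k) → Unique v → Satisfiable1DQBF φ v →
             (∀ (t : ℕ) → HasSize (SubsetSetoid (NegSat φ v)) t →
                HasSize (SkolemOn φ v Everything) (2 ^ (2 ^ k ∸ t)))
             × (∀ (S : Vec Bool k → Set) (s t : ℕ) → HasSize (SubsetSetoid S) s →
                HasSize (SubsetSetoid (S ∩ NegSat φ v)) t →
                HasSize (SkolemOn φ v S) (2 ^ (s ∸ t)))
lemma6 {k = k} φ v _ (g , g-skolem) =
    (λ t N-size →
       SkolemCount.skolem-size φ v {g} g-skolem (Everything-size k) (Everything∩-size N-size))
  , (λ S s t S-size SN-size → SkolemCount.skolem-size φ v {g} g-skolem S-size SN-size)
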